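{- (1) For $\lambda\mu$-terms $M,N$: if $M\to_{\beta\mu}N$ then $M\to^*_xN$. (2) If $M$ is a pure $\lambda\mu$-term and $M\to_xN$, then there exists a pure $\lambda\mu$-term $L$ such that $N\to^*_{xsub}L$.
   Context: $\lambda\mu$-terms: $M ::= x\mid\lambda x.M\mid MN\mid\mu\alpha.[\beta]M$; $\to_{\beta\mu}$: closure under all contexts of $(\lambda x.M)N\to M[N/x]$; $(\mu\alpha.[\beta]M)N\to\mu\gamma.(([\beta]M)[N\cdot\gamma/\alpha])$ ($\gamma$ fresh, $M[N\cdot\gamma/\alpha]$ replacing recursively each $[\alpha]M'$ by $[\gamma](M'[N\cdot\gamma/\alpha])N$); $\mu\delta.[\beta]\mu\gamma.[\alpha]M\to\mu\delta.(([\alpha]M)[\beta/\gamma])$; $\mu\alpha.[\alpha]M\to M$ ($\alpha\notin\mathrm{fn}(M)$). $\lambda\mu x$-terms: $M ::= x\mid\lambda x.M\mid MN\mid M\langle x:=N\rangle\mid\mu\alpha.[\beta]M\mid M\langle\alpha:=N\cdot\gamma\rangle$ (explicit substitutions may also be attached to commands $C=[\beta]M$). $\to_x$ is the closure under all contexts of the main rules $(\lambda x.M)N\to M\langle x:=N\rangle$; $(\mu\alpha.C)N\to\mu\gamma.(C\langle\alpha:=N\cdot\gamma\rangle)$ ($\gamma$ fresh); $\mu\beta.[\beta]M\to M$ ($\beta\notin\mathrm{fn}(M)$); $[\beta]\mu\gamma.C\to C[\beta/\gamma]$; and the substitution rules $x\langle x:=N\rangle\to N$; $M\langle x:=N\rangle\to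 M$ ($x\notin\mathrm{fv}(M)$); $(\lambda y.M)\langle x:=N\rangle\to\lambda y.(M\langle x:=N\rangle)$; $(PQ)\langle x:=N\rangle\to(P\langle x:=N\rangle)(Q\langle x:=N\rangle)$; $(\mu\alpha.[\beta]M)\langle x:=N\rangle\to\mu\alpha.[\beta](M\langle x:=N\rangle)$; $(\mu\delta.C)\langle\alpha:=N\cdot\gamma\rangle\to\mu\delta.(C\langle\alpha:=N\cdot\gamma\rangle)$; $([\alpha]M)\langle\alpha:=N\cdot\gamma\rangle\to[\gamma](M\langle\alpha:=N\cdot\gamma\rangle)N$; $([\beta]M)\langle\alpha:=N\cdot\gamma\rangle\to[\beta](M\langle\alpha:=N\cdot\gamma\rangle)$ ($\alpha\neq\beta$); $M\langle\alpha:=N\cdot\gamma\rangle\to M$ ($\alpha\notin\mathrm{fn}(M)$); $(\lambda x.M)\langle\alpha:=N\cdot\gamma\rangle\to\lambda x.(M\langle\alpha:=N\cdot\gamma\rangle)$; $(PQ)\langle\alpha:=N\cdot\gamma\rangle\to(P\langle\alpha:=N\cdot\gamma\rangle)(Q\langle\alpha:=N\cdot\gamma\rangle)$. $\to_{xsub}$ is the closure under all contexts of the substitution rules only (not the four main rules). -}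

module Defs where

-- Two independent sorts of variables, both de Bruijn indices (ℕ):
--   * term variables  (bound by λ and by M⟨x:=N⟩),
--   * names           (bound by μ and by M⟨α:=N·γ⟩).

open import Data.Nat using (ℕ; zero; suc; _≡ᵇ_)
open import Data.Bool using (if_then_else_)
open import Data.Sum using (_⊎_)
open import Relation.Binary.Construct.Closure.ReflexiveTransitive using (Star)

lift : (ℕ → ℕ) → ℕ → ℕ
lift ρ zero    = zero
lift ρ (suc k) = suc (ρ k)

swap01 : ℕ → ℕ
swap01 zero          = suc zero
swap01 (suc zero)    = zero
swap01 (suc (suc k)) = suc (suc k)

-- [β/γ] where γ is the innermost index 0 (which disappears)
ren0 : ℕ → ℕ → ℕ
ren0 β zero    = β
ren0 β (suc k) = k

-- Pure λμ-terms:  M ::= x | λx.M | M N | μα.[β]M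
-- 'mu β M' is μα.[β]M : it binds name 0 (= α) in β and M.

data Tm : Set where
  var : ℕ → Tm
  lam : Tm → Tm
  app : Tm → Tm → Tm
  mu  : ℕ → Tm → Tm

renV : (ℕ → ℕ) → Tm → Tm
renV ρ (var x)  = var (ρ x)
renV ρ (lam M)  = lam (renV (lift ρ) M)
renV ρ (app M N) = app (renV ρ M) (renV ρ N)
renV ρ (mu β M) = mu β (renV ρ M)

renN : (ℕ → ℕ) → Tm → Tm
renN ρ (var x)   = var x
renN ρ (lam M)   = lam (renN ρ M)
renN ρ (app M N) = app (renN ρ M) (renN ρ N)
renN ρ (mu β M)  = mu (lift ρ β) (renN (lift ρ) M)

wkV : Tm → Tm
wkV = renV suc

wkN : Tm → Tm
wkN = renN suc

extsV : (ℕ → Tm) → ℕ → Tm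
extsV σ zero    = var zero
extsV σ (suc k) = wkV (σ k)

substV : (ℕ → Tm) → Tm → Tm
substV σ (var x)   = σ x
substV σ (lam M)   = lam (substV (extsV σ) M)
substV σ (app M N) = app (substV σ M) (substV σ N)
substV σ (mu β M)  = mu β (substV (λ k → wkN (σ k)) M)

sub0 : Tm → ℕ → Tm
sub0 N zero    = N
sub0 N (suc k) = var k

_[_/0] : Tm → Tm → Tm
M [ N /0] = substV (sub0 N) M

-- Structural substitution M[N·γ/α]: here α is the name of index d in the
-- scope of M, and the fresh γ takes over the very same index d; N lives in
-- the name/variable scope of M.  Every [α]M' becomes [γ](M'[N·γ/α])N.
mutual
  ssub : ℕ → Tm → Tm → Tm
  ssub d N (var x)   = var x
  ssub d N (lam M)   = lam (ssub d (wkV N) M)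
  ssub d N (app P Q) = app (ssub d N P) (ssub d N Q)
  ssub d N (mu β M)  = mu β (sbody (suc d) (wkN N) β M)

  sbody : ℕ → Tm → ℕ → Tm → Tm
  sbody d N β M = if β ≡ᵇ d then app (ssub d N M) N else ssub d N M

infix 4 _→βμ_
data _→βμ_ : Tm → Tm → Set where
  β-rule  : ∀ {M N} → app (lam M) N →βμ (M [ N /0])
  -- (μα.[β]M)N → μγ.(([β]M)[N·γ/α]) , γ fresh
  μ-rule  : ∀ {β M N} → app (mu β M) N →βμ mu β (sbody zero (wkN N) β M)
  -- μδ.[β]μγ.[α]M → μδ.(([α]M)[β/γ])
  ρ-rule  : ∀ {β α M} → mu β (mu α M) →βμ mu (ren0 β α) (renN (ren0 β) M)
  -- μα.[α]M → M , α ∉ fn(M)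
  θ-rule  : ∀ {M} → mu zero (wkN M) →βμ M
  ξ-lam   : ∀ {M M'} → M →βμ M' → lam M →βμ lam M'
  ξ-appL  : ∀ {M M' N} → M →βμ M' → app M N →βμ app M' N
  ξ-appR  : ∀ {M N N'} → N →βμ N' → app M N →βμ app M N'
  ξ-mu    : ∀ {β M M'} → M →βμ M' → mu β M →βμ mu β M'

-- λμx-terms and commands
--   sub M N      = M⟨x:=N⟩       (binds term variable 0 in M)
--   nsub M N γ   = M⟨α:=N·γ⟩     (binds name 0 (= α) in M; N, γ outside)
--   mu C         = μα.C          (binds name 0 in C)
--   named β M    = [β]M
--   csub C N     = C⟨x:=N⟩ ,  cnsub C N γ = C⟨α:=N·γ⟩ (on commands)

mutual
  data XTm : Set where
    var  : ℕ → XTm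
    lam  : XTm → XTm
    app  : XTm → XTm → XTm
    sub  : XTm → XTm → XTm
    mu   : XCmd → XTm
    nsub : XTm → XTm → ℕ → XTm

  data XCmd : Set where
    named : ℕ → XTm → XCmd
    csub  : XCmd → XTm → XCmd
    cnsub : XCmd → XTm → ℕ → XCmd

mutual
  xrenV : (ℕ → ℕ) → XTm → XTm
  xrenV ρ (var x)      = var (ρ x)
  xrenV ρ (lam M)      = lam (xrenV (lift ρ) M)
  xrenV ρ (app M N)    = app (xrenV ρ M) (xrenV ρ N)
  xrenV ρ (sub M N)    = sub (xrenV (lift ρ) M) (xrenV ρ N)
  xrenV ρ (mu C)       = mu (xrenVC ρ C)
  xrenV ρ (nsub M N γ) = nsub (xrenV ρ M) (xrenV ρ N) γ

  xrenVC : (ℕ → ℕ) → XCmd → XCmd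
  xrenVC ρ (named β M)   = named β (xrenV ρ M)
  xrenVC ρ (csub C N)    = csub (xrenVC (lift ρ) C) (xrenV ρ N)
  xrenVC ρ (cnsub C N γ) = cnsub (xrenVC ρ C) (xrenV ρ N) γ

mutual
  xrenN : (ℕ → ℕ) → XTm → XTm
  xrenN ρ (var x)      = var x
  xrenN ρ (lam M)      = lam (xrenN ρ M)
  xrenN ρ (app M N)    = app (xrenN ρ M) (xrenN ρ N)
  xrenN ρ (sub M N)    = sub (xrenN ρ M) (xrenN ρ N)
  xrenN ρ (mu C)       = mu (xrenNC (lift ρ) C)
  xrenN ρ (nsub M N γ) = nsub (xrenN (lift ρ) M) (xrenN ρ N) (ρ γ)

  xrenNC : (ℕ → ℕ) → XCmd → XCmd
  xrenNC ρ (named β M)   = named (ρ β) (xrenN ρ M)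
  xrenNC ρ (csub C N)    = csub (xrenNC ρ C) (xrenN ρ N)
  xrenNC ρ (cnsub C N γ) = cnsub (xrenNC (lift ρ) C) (xrenN ρ N) (ρ γ)

xwkV : XTm → XTm
xwkV = xrenV suc

xwkN : XTm → XTm
xwkN = xrenN suc

⌜_⌝ : Tm → XTm
⌜ var x ⌝   = var x
⌜ lam M ⌝   = lam ⌜ M ⌝
⌜ app M N ⌝ = app ⌜ M ⌝ ⌜ N ⌝
⌜ mu β M ⌝  = mu (named β ⌜ M ⌝)

data MainT : XTm → XTm → Set where
  B     : ∀ {M N} → MainT (app (lam M) N) (sub M N)
  -- (μα.C)N → μγ.(C⟨α:=N·γ⟩) , γ fresh
  Mu    : ∀ {C N} → MainT (app (mu C) N)
                          (mu (cnsub (xrenNC (lift suc) C) (xwkN N) zero))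
  -- μβ.[β]M → M , β ∉ fn(M)
  Theta : ∀ {M} → MainT (mu (named zero (xwkN M))) M

data MainC : XCmd → XCmd → Set where
  -- [β]μγ.C → C[β/γ]
  Rho : ∀ {β C} → MainC (named β (mu C)) (xrenNC (ren0 β) C)

data SubT : XTm → XTm → Set where
  s-var   : ∀ {N} → SubT (sub (var zero) N) N
  -- M⟨x:=N⟩ → M , x ∉ fv(M)
  s-gc    : ∀ {M N} → SubT (sub (xwkV M) N) M
  -- (λy.M)⟨x:=N⟩ → λy.(M⟨x:=N⟩)
  s-lam   : ∀ {M N} → SubT (sub (lam M) N) (lam (sub (xrenV swap01 M) (xwkV N)))
  s-app   : ∀ {P Q N} → SubT (sub (app P Q) N) (app (sub P N) (sub Q N))
  s-mu    : ∀ {β M N} → SubT (sub (mu (named β M)) N) (mu (named β (sub M (xwkN N))))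
  -- (μδ.C)⟨α:=N·γ⟩ → μδ.(C⟨α:=N·γ⟩)
  n-mu    : ∀ {C N γ} → SubT (nsub (mu C) N γ)
                             (mu (cnsub (xrenNC swap01 C) (xwkN N) (suc γ)))
  -- M⟨α:=N·γ⟩ → M , α ∉ fn(M)
  n-gc    : ∀ {M N γ} → SubT (nsub (xwkN M) N γ) M
  n-lam   : ∀ {M N γ} → SubT (nsub (lam M) N γ) (lam (nsub M (xwkV N) γ))
  n-app   : ∀ {P Q N γ} → SubT (nsub (app P Q) N γ) (app (nsub P N γ) (nsub Q N γ))

data SubC : XCmd → XCmd → Set where
  -- ([α]M)⟨α:=N·γ⟩ → [γ](M⟨α:=N·γ⟩)N
  n-named-eq  : ∀ {M N γ} → SubC (cnsub (named zero M) N γ)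
                                 (named γ (app (nsub M N γ) N))
  -- ([β]M)⟨α:=N·γ⟩ → [β](M⟨α:=N·γ⟩) , α ≠ β
  n-named-neq : ∀ {β M N γ} → SubC (cnsub (named (suc β) M) N γ)
                                   (named β (nsub M N γ))

module Closure (RT : XTm → XTm → Set) (RC : XCmd → XCmd → Set) where
  mutual
    data StepT : XTm → XTm → Set where
      root   : ∀ {M N} → RT M N → StepT M N
      c-lam  : ∀ {M M'} → StepT M M' → StepT (lam M) (lam M')
      c-appL : ∀ {M M' N} → StepT M M' → StepT (app M N) (app M' N)
      c-appR : ∀ {M N N'} → StepT N N' → StepT (app M N) (app M N')
      c-subL : ∀ {M M' N} → StepT M M' → StepT (sub M N) (sub M' N)
      c-subR : ∀ {M N N'} → StepT N N' → StepT (sub M N) (sub M N')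
      c-mu   : ∀ {C C'} → StepC C C' → StepT (mu C) (mu C')
      c-nsubL : ∀ {M M' N γ} → StepT M M' → StepT (nsub M N γ) (nsub M' N γ)
      c-nsubR : ∀ {M N N' γ} → StepT N N' → StepT (nsub M N γ) (nsub M N' γ)

    data StepC : XCmd → XCmd → Set where
      root    : ∀ {C D} → RC C D → StepC C D
      c-named : ∀ {β M M'} → StepT M M' → StepC (named β M) (named β M')
      c-csubL : ∀ {C C' N} → StepC C C' → StepC (csub C N) (csub C' N)
      c-csubR : ∀ {C N N'} → StepT N N' → StepC (csub C N) (csub C N')
      c-cnsubL : ∀ {C C' N γ} → StepC C C' → StepC (cnsub C N γ) (cnsub C' N γ)
      c-cnsubR : ∀ {C N N' γ} → StepT N N' → StepC (cnsub C N γ) (cnsub C N' γ)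

XRootT : XTm → XTm → Set
XRootT M N = MainT M N ⊎ SubT M N

XRootC : XCmd → XCmd → Set
XRootC C D = MainC C D ⊎ SubC C D

infix 4 _→x_ _→xsub_ _→*x_ _→*xsub_
_→x_ : XTm → XTm → Set
_→x_ = Closure.StepT XRootT XRootC

_→xsub_ : XTm → XTm → Set
_→xsub_ = Closure.StepT SubT SubC

_→*x_ : XTm → XTm → Set
_→*x_ = Star _→x_

_→*xsub_ : XTm → XTm → Set
_→*xsub_ = Star _→xsub_

-- A main rule of λμx only creates an explicit substitution, and the
-- substitution rules propagate it through a pure term until exactly the
-- meta-level substitution M[N/x] (resp. the structural substitution
-- M[N·γ/α]) of the λμ-calculus is left; the ρ- and θ-rules are the same in
-- both calculi.  For (2), a step from a pure term either
-- happens under pure constructors or is a root step; of these, B and Mu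
-- reduce by (1) to pure terms using substitution rules only, while Theta
-- and Rho already yield pure terms.
module Submission where

open import Defs
open import Data.Product using (_×_; ∃-syntax; Σ-syntax; _,_)
open import Data.Nat using (ℕ; zero; suc; _≡ᵇ_)
open import Data.Nat.Properties using (≡ᵇ⇒≡)
open import Data.Bool using (true; false; if_then_else_)
open import Data.Unit using (tt)
open import Data.Sum using (inj₁; inj₂)
open import Function using (id; _∘_)
open import Relation.Binary.PropositionalEquality
  using (_≡_; refl; sym; trans; cong; cong₂; subst; _≗_)
open import Relation.Binary.Construct.Closure.ReflexiveTransitive
  using (Star; ε; _◅_; _◅◅_; gmap)

lift-cong : ∀ {f g : ℕ → ℕ} → f ≗ g → lift f ≗ lift g
lift-cong f≗g zero    = refl
lift-cong f≗g (suc x) = cong suc (f≗g x)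

lift-∘ : ∀ (f g : ℕ → ℕ) → lift f ∘ lift g ≗ lift (f ∘ g)
lift-∘ f g zero    = refl
lift-∘ f g (suc x) = refl

renV-cong : ∀ {f g} → f ≗ g → renV f ≗ renV g
renV-cong f≗g (var x)   = cong var (f≗g x)
renV-cong f≗g (lam M)   = cong lam (renV-cong (lift-cong f≗g) M)
renV-cong f≗g (app M N) = cong₂ app (renV-cong f≗g M) (renV-cong f≗g N)
renV-cong f≗g (mu β M)  = cong (mu β) (renV-cong f≗g M)

renV-∘ : ∀ f g M → renV f (renV g M) ≡ renV (f ∘ g) M
renV-∘ f g (var x)   = refl
renV-∘ f g (lam M)   =
  cong lam (trans (renV-∘ (lift f) (lift g) M) (renV-cong (lift-∘ f g) M))
renV-∘ f g (app M N) = cong₂ app (renV-∘ f g M) (renV-∘ f g N)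
renV-∘ f g (mu β M)  = cong (mu β) (renV-∘ f g M)

renV-id : ∀ {f} → f ≗ id → renV f ≗ id
renV-id f≗id (var x)   = cong var (f≗id x)
renV-id f≗id (lam M)   = cong lam (renV-id (λ { zero → refl ; (suc x) → cong suc (f≗id x) }) M)
renV-id f≗id (app M N) = cong₂ app (renV-id f≗id M) (renV-id f≗id N)
renV-id f≗id (mu β M)  = cong (mu β) (renV-id f≗id M)

renN-cong : ∀ {f g} → f ≗ g → renN f ≗ renN g
renN-cong f≗g (var x)   = refl
renN-cong f≗g (lam M)   = cong lam (renN-cong f≗g M)
renN-cong f≗g (app M N) = cong₂ app (renN-cong f≗g M) (renN-cong f≗g N)
renN-cong f≗g (mu β M)  = cong₂ mu (lift-cong f≗g β) (renN-cong (lift-cong f≗g) M)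

renN-∘ : ∀ f g M → renN f (renN g M) ≡ renN (f ∘ g) M
renN-∘ f g (var x)   = refl
renN-∘ f g (lam M)   = cong lam (renN-∘ f g M)
renN-∘ f g (app M N) = cong₂ app (renN-∘ f g M) (renN-∘ f g N)
renN-∘ f g (mu β M)  = cong₂ mu (lift-∘ f g β)
  (trans (renN-∘ (lift f) (lift g) M) (renN-cong (lift-∘ f g) M))

⌜⌝-renV : ∀ ρ M → ⌜ renV ρ M ⌝ ≡ xrenV ρ ⌜ M ⌝
⌜⌝-renV ρ (var x)   = refl
⌜⌝-renV ρ (lam M)   = cong lam (⌜⌝-renV (lift ρ) M)
⌜⌝-renV ρ (app M N) = cong₂ app (⌜⌝-renV ρ M) (⌜⌝-renV ρ N)
⌜⌝-renV ρ (mu β M)  = cong (λ t → mu (named β t)) (⌜⌝-renV ρ M)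

⌜⌝-renN : ∀ ρ M → ⌜ renN ρ M ⌝ ≡ xrenN ρ ⌜ M ⌝
⌜⌝-renN ρ (var x)   = refl
⌜⌝-renN ρ (lam M)   = cong lam (⌜⌝-renN ρ M)
⌜⌝-renN ρ (app M N) = cong₂ app (⌜⌝-renN ρ M) (⌜⌝-renN ρ N)
⌜⌝-renN ρ (mu β M)  = cong (λ t → mu (named (lift ρ β) t)) (⌜⌝-renN (lift ρ) M)

module Sub = Closure SubT SubC
module X   = Closure XRootT XRootC

infix 4 _→*xsubC_
_→*xsubC_ : XCmd → XCmd → Set
_→*xsubC_ = Star Sub.StepC

→*xsub-app : ∀ {P P′ Q Q′} → P →*xsub P′ → Q →*xsub Q′ → app P Q →*xsub app P′ Q′
→*xsub-app {Q = Q} P↠ Q↠ = gmap (λ t → app t Q) Sub.c-appL P↠ ◅◅ gmap (app _) Sub.c-appR Q↠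

→*xsub-named : ∀ {β M M′} → M →*xsub M′ → named β M →*xsubC named β M′
→*xsub-named = gmap (named _) Sub.c-named

→*xsub-mu : ∀ {C C′} → C →*xsubC C′ → mu C →*xsub mu C′
→*xsub-mu = gmap mu Sub.c-mu

module _ {RT RT′ : XTm → XTm → Set} {RC RC′ : XCmd → XCmd → Set}
         (fT : ∀ {M N} → RT M N → RT′ M N) (fC : ∀ {C D} → RC C D → RC′ C D) where
  private
    module R  = Closure RT RC
    module R′ = Closure RT′ RC′

  mutual
    Closure-monoT : ∀ {M N} → R.StepT M N → R′.StepT M N
    Closure-monoT (R.root r)    = R′.root (fT r)
    Closure-monoT (R.c-lam s)   = R′.c-lam (Closure-monoT s)
    Closure-monoT (R.c-appL s)  = R′.c-appL (Closure-monoT s)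
    Closure-monoT (R.c-appR s)  = R′.c-appR (Closure-monoT s)
    Closure-monoT (R.c-subL s)  = R′.c-subL (Closure-monoT s)
    Closure-monoT (R.c-subR s)  = R′.c-subR (Closure-monoT s)
    Closure-monoT (R.c-mu s)    = R′.c-mu (Closure-monoC s)
    Closure-monoT (R.c-nsubL s) = R′.c-nsubL (Closure-monoT s)
    Closure-monoT (R.c-nsubR s) = R′.c-nsubR (Closure-monoT s)

    Closure-monoC : ∀ {C D} → R.StepC C D → R′.StepC C D
    Closure-monoC (R.root r)     = R′.root (fC r)
    Closure-monoC (R.c-named s)  = R′.c-named (Closure-monoT s)
    Closure-monoC (R.c-csubL s)  = R′.c-csubL (Closure-monoC s)
    Closure-monoC (R.c-csubR s)  = R′.c-csubR (Closure-monoT s)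
    Closure-monoC (R.c-cnsubL s) = R′.c-cnsubL (Closure-monoC s)
    Closure-monoC (R.c-cnsubR s) = R′.c-cnsubR (Closure-monoT s)

→*xsub⇒→*x : ∀ {M N} → M →*xsub N → M →*x N
→*xsub⇒→*x = gmap id (Closure-monoT inj₂ inj₂)

wkV-sub0 : ∀ P i → wkV (sub0 P i) ≡ sub0 (wkV P) (swap01 (suc i))
wkV-sub0 P zero    = refl
wkV-sub0 P (suc i) = refl

wkN-sub0 : ∀ P i → wkN (sub0 P i) ≡ sub0 (wkN P) i
wkN-sub0 P zero    = refl
wkN-sub0 P (suc i) = refl

-- The renaming ρ sends the substituted variable to 0 and the others to their
-- successors, so σ ≗ sub0 P ∘ ρ says that substV σ is M[P/x] up to ρ.
sub-→*xsub-substV : ∀ M {ρ σ P} → σ ≗ sub0 P ∘ ρ →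
                    sub ⌜ renV ρ M ⌝ ⌜ P ⌝ →*xsub ⌜ substV σ M ⌝
sub-→*xsub-substV (var x) {ρ} σ≗ rewrite σ≗ x with ρ x
... | zero  = Sub.root s-var ◅ ε
... | suc y = Sub.root (s-gc {M = var y}) ◅ ε
sub-→*xsub-substV (lam M) {ρ} {σ} {P} σ≗ =
  Sub.root s-lam ◅ gmap lam Sub.c-lam
    (subst (_→*xsub ⌜ substV (extsV σ) M ⌝) body
      (sub-→*xsub-substV M extsV-σ≗))
  where
  extsV-σ≗ : extsV σ ≗ sub0 (wkV P) ∘ swap01 ∘ lift ρ
  extsV-σ≗ zero    = refl
  extsV-σ≗ (suc k) = trans (cong wkV (σ≗ k)) (wkV-sub0 P (ρ k))
  body : sub ⌜ renV (swap01 ∘ lift ρ) M ⌝ ⌜ wkV P ⌝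
         ≡ sub (xrenV swap01 ⌜ renV (lift ρ) M ⌝) (xwkV ⌜ P ⌝)
  body = cong₂ sub
    (trans (cong ⌜_⌝ (sym (renV-∘ swap01 (lift ρ) M))) (⌜⌝-renV swap01 (renV (lift ρ) M)))
    (⌜⌝-renV suc P)
sub-→*xsub-substV (app M N) σ≗ =
  Sub.root s-app ◅ →*xsub-app (sub-→*xsub-substV M σ≗) (sub-→*xsub-substV N σ≗)
sub-→*xsub-substV (mu β M) {ρ} {σ} {P} σ≗ =
  Sub.root s-mu ◅ →*xsub-mu (→*xsub-named
    (subst (λ t → sub ⌜ renV ρ M ⌝ t →*xsub ⌜ substV (wkN ∘ σ) M ⌝) (⌜⌝-renN suc P)
      (sub-→*xsub-substV M λ x → trans (cong wkN (σ≗ x)) (wkN-sub0 P (ρ x)))))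

sub-→*xsub-[/0] : ∀ M N → sub ⌜ M ⌝ ⌜ N ⌝ →*xsub ⌜ M [ N /0] ⌝
sub-→*xsub-[/0] M N =
  subst (λ t → sub ⌜ t ⌝ ⌜ N ⌝ →*xsub ⌜ M [ N /0] ⌝) (renV-id (λ _ → refl) M)
    (sub-→*xsub-substV M λ _ → refl)

-- Renaming by isolate d moves the name d to 0, making room for the bound α
-- of nsub while γ keeps index d.
isolate : ℕ → ℕ → ℕ
isolate d x = if x ≡ᵇ d then 0 else suc x

swap01-isolate : ∀ d k → swap01 (suc (isolate d k)) ≡ isolate (suc d) (suc k)
swap01-isolate d k with k ≡ᵇ d
... | true  = refl
... | false = refl

mutual
  nsub-→*xsub-ssub : ∀ M {ρ d} N → ρ ≗ isolate d →
                     nsub ⌜ renN ρ M ⌝ ⌜ N ⌝ d →*xsub ⌜ ssub d N M ⌝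
  nsub-→*xsub-ssub (var x) N ρ≗ = Sub.root (n-gc {M = var x}) ◅ ε
  nsub-→*xsub-ssub (lam M) {ρ} {d} N ρ≗ =
    Sub.root n-lam ◅ gmap lam Sub.c-lam
      (subst (λ t → nsub ⌜ renN ρ M ⌝ t d →*xsub ⌜ ssub d (wkV N) M ⌝) (⌜⌝-renV suc N)
        (nsub-→*xsub-ssub M (wkV N) ρ≗))
  nsub-→*xsub-ssub (app M M′) N ρ≗ =
    Sub.root n-app ◅ →*xsub-app (nsub-→*xsub-ssub M N ρ≗) (nsub-→*xsub-ssub M′ N ρ≗)
  nsub-→*xsub-ssub (mu β M) {ρ} {d} N ρ≗ =
    Sub.root n-mu ◅ →*xsub-mu
      (subst (_→*xsubC named β ⌜ sbody (suc d) (wkN N) β M ⌝) body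
        (named-→*xsub-sbody β M (wkN N) lift-ρ≗))
    where
    ρ′ : ℕ → ℕ
    ρ′ = swap01 ∘ lift ρ
    lift-ρ≗ : ρ′ ≗ isolate (suc d)
    lift-ρ≗ zero    = refl
    lift-ρ≗ (suc k) = trans (cong (swap01 ∘ suc) (ρ≗ k)) (swap01-isolate d k)
    body : cnsub (named (ρ′ β) ⌜ renN ρ′ M ⌝) ⌜ wkN N ⌝ (suc d)
           ≡ cnsub (named (ρ′ β) (xrenN swap01 ⌜ renN (lift ρ) M ⌝)) (xwkN ⌜ N ⌝) (suc d)
    body = cong₂ (λ a b → cnsub (named (ρ′ β) a) b (suc d))
      (trans (cong ⌜_⌝ (sym (renN-∘ swap01 (lift ρ) M))) (⌜⌝-renN swap01 (renN (lift ρ) M)))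
      (⌜⌝-renN suc N)

  named-→*xsub-sbody : ∀ β M {ρ d} N → ρ ≗ isolate d →
    cnsub (named (ρ β) ⌜ renN ρ M ⌝) ⌜ N ⌝ d →*xsubC named β ⌜ sbody d N β M ⌝
  named-→*xsub-sbody β M {ρ} {d} N ρ≗ rewrite ρ≗ β with β ≡ᵇ d | ≡ᵇ⇒≡ β d
  ... | true  | β≡d rewrite β≡d tt =
    Sub.root n-named-eq ◅
      gmap (λ t → named d (app t ⌜ N ⌝)) (Sub.c-named ∘ Sub.c-appL) (nsub-→*xsub-ssub M N ρ≗)
  ... | false | _ =
    Sub.root n-named-neq ◅ →*xsub-named (nsub-→*xsub-ssub M N ρ≗)

Mu-contractum-→*xsub : ∀ β M N →
  mu (cnsub (xrenNC (lift suc) (named β ⌜ M ⌝)) (xwkN ⌜ N ⌝) zero)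
    →*xsub ⌜ mu β (sbody zero (wkN N) β M) ⌝
Mu-contractum-→*xsub β M N = →*xsub-mu
  (subst (_→*xsubC named β ⌜ sbody zero (wkN N) β M ⌝)
    (cong₂ (λ a b → cnsub (named (lift suc β) a) b zero) (⌜⌝-renN (lift suc) M) (⌜⌝-renN suc N))
    (named-→*xsub-sbody β M (wkN N) λ { zero → refl ; (suc k) → refl }))

→βμ⇒→*x : ∀ {M N} → M →βμ N → ⌜ M ⌝ →*x ⌜ N ⌝
→βμ⇒→*x (β-rule {M} {N}) = X.root (inj₁ B) ◅ →*xsub⇒→*x (sub-→*xsub-[/0] M N)
→βμ⇒→*x (μ-rule {β} {M} {N}) = X.root (inj₁ Mu) ◅ →*xsub⇒→*x (Mu-contractum-→*xsub β M N)
→βμ⇒→*x (ρ-rule {β} {α} {M}) =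
  subst (λ t → ⌜ mu β (mu α M) ⌝ →*x mu (named (ren0 β α) t)) (sym (⌜⌝-renN (ren0 β) M))
    (X.c-mu (X.root (inj₁ Rho)) ◅ ε)
→βμ⇒→*x (θ-rule {M}) =
  subst (λ t → mu (named zero t) →*x ⌜ M ⌝) (sym (⌜⌝-renN suc M))
    (X.root (inj₁ Theta) ◅ ε)
→βμ⇒→*x (ξ-lam s)      = gmap lam X.c-lam (→βμ⇒→*x s)
→βμ⇒→*x (ξ-appL s)     = gmap (λ t → app t _) X.c-appL (→βμ⇒→*x s)
→βμ⇒→*x (ξ-appR s)     = gmap (app _) X.c-appR (→βμ⇒→*x s)
→βμ⇒→*x (ξ-mu {β} s)   = gmap (λ t → mu (named β t)) (X.c-mu ∘ X.c-named) (→βμ⇒→*x s)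

data Pure : XTm → Set where
  var : ∀ x → Pure (var x)
  lam : ∀ {M} → Pure M → Pure (lam M)
  app : ∀ {M N} → Pure M → Pure N → Pure (app M N)
  mu  : ∀ {β M} → Pure M → Pure (mu (named β M))

⌜⌝-pure : ∀ M → Pure ⌜ M ⌝
⌜⌝-pure (var x)   = var x
⌜⌝-pure (lam M)   = lam (⌜⌝-pure M)
⌜⌝-pure (app M N) = app (⌜⌝-pure M) (⌜⌝-pure N)
⌜⌝-pure (mu β M)  = mu (⌜⌝-pure M)

pure⇒⌜⌝ : ∀ {X} → Pure X → Σ[ M ∈ Tm ] ⌜ M ⌝ ≡ X
pure⇒⌜⌝ (var x) = var x , refl
pure⇒⌜⌝ (lam p) with pure⇒⌜⌝ p
... | M , refl = lam M , refl
pure⇒⌜⌝ (app p q) with pure⇒⌜⌝ p | pure⇒⌜⌝ q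
... | M , refl | N , refl = app M N , refl
pure⇒⌜⌝ (mu {β} p) with pure⇒⌜⌝ p
... | M , refl = mu β M , refl

xrenN-pure : ∀ ρ {X} → Pure X → Pure (xrenN ρ X)
xrenN-pure ρ (var x)   = var x
xrenN-pure ρ (lam p)   = lam (xrenN-pure ρ p)
xrenN-pure ρ (app p q) = app (xrenN-pure ρ p) (xrenN-pure ρ q)
xrenN-pure ρ (mu p)    = mu (xrenN-pure (lift ρ) p)

xrenN-pure⁻¹ : ∀ ρ X → Pure (xrenN ρ X) → Pure X
xrenN-pure⁻¹ ρ (var x)           _         = var x
xrenN-pure⁻¹ ρ (lam X)           (lam p)   = lam (xrenN-pure⁻¹ ρ X p)
xrenN-pure⁻¹ ρ (app X Y)         (app p q) = app (xrenN-pure⁻¹ ρ X p) (xrenN-pure⁻¹ ρ Y q)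
xrenN-pure⁻¹ ρ (mu (named β X))  (mu p)    = mu (xrenN-pure⁻¹ (lift ρ) X p)
xrenN-pure⁻¹ ρ (sub X Y)         ()
xrenN-pure⁻¹ ρ (mu (csub C X))   ()
xrenN-pure⁻¹ ρ (mu (cnsub C X γ)) ()
xrenN-pure⁻¹ ρ (nsub X Y γ)      ()

ReachesPure : XTm → Set
ReachesPure N = Σ[ L ∈ XTm ] (N →*xsub L × Pure L)

ReachesPure-map : ∀ {N} (f : XTm → XTm) → (∀ {a b} → a →xsub b → f a →xsub f b) →
                  (∀ {a} → Pure a → Pure (f a)) → ReachesPure N → ReachesPure (f N)
ReachesPure-map f step pure (L , N↠L , L-pure) = f L , gmap f step N↠L , pure L-pure

→*xsub-⌜⌝⇒ReachesPure : ∀ {N} M → N →*xsub ⌜ M ⌝ → ReachesPure N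
→*xsub-⌜⌝⇒ReachesPure M N↠M = ⌜ M ⌝ , N↠M , ⌜⌝-pure M

→x-pure⇒ReachesPure : ∀ {M N} → M →x N → Pure M → ReachesPure N
→x-pure⇒ReachesPure (X.root (inj₁ B)) (app (lam p) q) with pure⇒⌜⌝ p | pure⇒⌜⌝ q
... | M , refl | N , refl = →*xsub-⌜⌝⇒ReachesPure (M [ N /0]) (sub-→*xsub-[/0] M N)
→x-pure⇒ReachesPure (X.root (inj₁ Mu)) (app (mu {β} p) q) with pure⇒⌜⌝ p | pure⇒⌜⌝ q
... | M , refl | N , refl =
  →*xsub-⌜⌝⇒ReachesPure (mu β (sbody zero (wkN N) β M)) (Mu-contractum-→*xsub β M N)
→x-pure⇒ReachesPure (X.root (inj₁ (Theta {M}))) (mu p) = M , ε , xrenN-pure⁻¹ suc M p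
→x-pure⇒ReachesPure (X.root (inj₂ s-var)) ()
→x-pure⇒ReachesPure (X.root (inj₂ s-gc))  ()
→x-pure⇒ReachesPure (X.root (inj₂ s-lam)) ()
→x-pure⇒ReachesPure (X.root (inj₂ s-app)) ()
→x-pure⇒ReachesPure (X.root (inj₂ s-mu))  ()
→x-pure⇒ReachesPure (X.root (inj₂ n-mu))  ()
→x-pure⇒ReachesPure (X.root (inj₂ n-gc))  ()
→x-pure⇒ReachesPure (X.root (inj₂ n-lam)) ()
→x-pure⇒ReachesPure (X.root (inj₂ n-app)) ()
→x-pure⇒ReachesPure (X.c-lam s) (lam p) =
  ReachesPure-map lam Sub.c-lam lam (→x-pure⇒ReachesPure s p)
→x-pure⇒ReachesPure (X.c-appL {N = N} s) (app p q) =
  ReachesPure-map (λ t → app t N) Sub.c-appL (λ r → app r q) (→x-pure⇒ReachesPure s p)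
→x-pure⇒ReachesPure (X.c-appR {M = M} s) (app p q) =
  ReachesPure-map (app M) Sub.c-appR (app p) (→x-pure⇒ReachesPure s q)
→x-pure⇒ReachesPure (X.c-mu (X.root (inj₁ (Rho {β})))) (mu (mu p)) =
  _ , ε , mu (xrenN-pure (ren0 β) p)
→x-pure⇒ReachesPure (X.c-mu (X.root (inj₂ ()))) (mu p)
→x-pure⇒ReachesPure (X.c-mu (X.c-named {β} s)) (mu p) =
  ReachesPure-map (λ t → mu (named β t)) (Sub.c-mu ∘ Sub.c-named) mu (→x-pure⇒ReachesPure s p)

proposition3p2 : (∀ {M N : Tm} → M →βμ N → ⌜ M ⌝ →*x ⌜ N ⌝)
                 × (∀ (M : Tm) (N : XTm) → ⌜ M ⌝ →x N → ∃[ L ] (N →*xsub ⌜ L ⌝))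
proposition3p2 = →βμ⇒→*x , pure-step
  where
  pure-step : ∀ (M : Tm) (N : XTm) → ⌜ M ⌝ →x N → ∃[ L ] (N →*xsub ⌜ L ⌝)
  pure-step M N s with →x-pure⇒ReachesPure s (⌜⌝-pure M)
  ... | _ , N↠ , L-pure with pure⇒⌜⌝ L-pure
  ... | L , refl = L , N↠
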